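{- Let $\Gamma$ be a coloring and $\Omega$ a $k$-ordering of $T_{d,k}$, with initial $d$-cell $\mathcal T$, and consider the induced left action of $G_{d,k}$ on the $d$-cells of $T_{d,k}$. (1) For every $g\in G_{d,k}$ and $m\ge0$, the unique reduced word representing $g$ has length $m$ if and only if $\mathrm{dist}(g.\mathcal T,\mathcal T)=m$. (2) The action of $G_{d,k}$ on the $d$-cells of $T_{d,k}$ is simply transitive.
   Context: $[\![d]\!]=\{0,\dots,d\}$. $G_{d,k}=\langle\alpha_0,\dots,\alpha_d\mid\alpha_i^k=e\rangle$, the free product of $d+1$ cyclic groups of order $k$. A word $\alpha_{j_m}^{l_m}\cdots\alpha_{j_1}^{l_1}$ has length $m$; it is reduced if all $l_r\in\{1,\dots,k-1\}$ and $j_r\ne j_{r+1}$; every element has a unique reduced word. Arboreal complex $T_{d,k}$: $B_0$ is a single $d$-cell $\mathcal T$ with its faces; $B_{n+1}$ is obtained from $B_n$ by attaching to each $(d-1)$-cell of $B_n$ contained in exactly one $d$-cell of $B_n$ $k-1$ new $d$-cells, each with a new vertex; $T_{d,k}=\bigcup_nB_n$. A coloring $\Gamma:T^0_{d,k}\to[\![d]\!]$ is injective on each $d$-cell, and $\Gamma(\rho)=\{\Gamma(v):v\in\rho\}$. A $k$-ordering $\Omega$ assigns to each $(d-1)$-cell $\sigma$ a transitive homomorphism $\Omega_\sigma:C_k\to\mathcal S_{\delta(\sigma)}$, $\delta(\sigma)$ the set of $d$-cells containing $\sigma$. Left action: $\alpha_i^l.\tau=\Omega_\sigma(\alpha_i^l).\tau$,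 $\sigma$ the $(d-1)$-cell of $\tau$ with color $[\![d]\!]\setminus\{i\}$ (identifying $C_k$ with $\langle\alpha_i\rangle$), extended to words (well defined). The line graph of $T_{d,k}$ has the $d$-cells as vertices, two adjacent if their intersection is a $(d-1)$-cell; $\mathrm{dist}$ is its graph distance. -}

module Defs where

open import Data.Nat using (ℕ; zero; suc; _∸_; _+_; _<_; _%_)
open import Data.Nat.DivMod using (m%n<n)
open import Data.Fin using (Fin; zero; suc; toℕ; fromℕ<; _≟_)
open import Data.Bool using (Bool; true; false; not; T)
open import Data.Maybe using (Maybe; just; nothing; fromMaybe)
import Data.Maybe as Maybe
open import Data.List using (List; []; _∷_; length)
open import Data.Product using (Σ; _×_; _,_; ∃; ∃-syntax)
open import Data.Unit using (⊤)
open import Data.Empty using (⊥)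
open import Relation.Nullary using (¬_; yes; no; ⌊_⌋)
open import Relation.Binary.PropositionalEquality using (_≡_; _≢_)
open import Function using (_∘_)

-- Cyclic group C_k = ℤ/k, carried by Fin k with addition mod k.
_⊕_ : ∀ {k} → Fin k → Fin k → Fin k
_⊕_ {suc n} a b = fromℕ< (m%n<n (toℕ a + toℕ b) (suc n))

find : ∀ {n m} → (Fin n → Fin m) → Fin m → Maybe (Fin n)
find {zero} f i = nothing
find {suc n} f i with f zero ≟ i
... | yes _ = just zero
... | no _ = Maybe.map suc (find (f ∘ suc) i)

module Complex (d k : ℕ) where

  -- Slots 0..d of a d-cell; a d-cell is stored with its d+1 vertices in slots.
  Slot : Set
  Slot = Fin (suc d)

  -- d-cells of T_{d,k}.  root = 𝒯 (the single d-cell of B_0).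
  -- child τ j h c : the c-th of the k-1 new d-cells attached along the
  -- (d-1)-face of τ opposite slot j; its new vertex occupies slot j.
  -- h : the face opposite j is a free face (in exactly one d-cell) when
  -- τ is created, i.e. τ = root or j is not the slot τ was attached by.
  data Cell : Set
  Free : Cell → Slot → Set

  data Cell where
    root  : Cell
    child : (τ : Cell) (j : Slot) → Free τ j → Fin (k ∸ 1) → Cell

  Free root j = ⊤
  Free (child τ j' h c) j = T (not ⌊ j ≟ j' ⌋)

  -- Vertices of T_{d,k}: the d+1 vertices of 𝒯, and the new vertex of each new d-cell.
  data Vertex : Set where
    init : Slot → Vertex
    new  : (τ : Cell) (j : Slot) → Free τ j → Fin (k ∸ 1) → Vertex

  vert : Cell → Slot → Vertex
  vert root i = init i
  vert (child τ j h c) i with i ≟ j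
  ... | yes _ = new τ j h c
  ... | no _ = vert τ i

  _∈face_,_ : Vertex → Cell → Slot → Set
  v ∈face τ , j = ∃[ i ] (i ≢ j × vert τ i ≡ v)

  SameFace : Cell → Slot → Cell → Slot → Set
  SameFace τ j τ' j' = ∀ v → ((v ∈face τ , j) → (v ∈face τ' , j')) × ((v ∈face τ' , j') → (v ∈face τ , j))

  _∈δ_,_ : Cell → Cell → Slot → Set
  τ ∈δ ρ , j = ∃[ i ] SameFace τ i ρ j

  record Coloring : Set where
    field
      Γ   : Vertex → Fin (suc d)
      inj : ∀ τ i i' → Γ (vert τ i) ≡ Γ (vert τ i') → i ≡ i'

  -- k-ordering: for each (d-1)-cell σ (given by a representative face (ρ , j)),
  -- a transitive homomorphism Ω_σ : C_k → Sym(δ(σ)); only its values on δ(σ) matter.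
  record KOrdering : Set where
    field
      Ω        : Cell → Slot → Fin k → Cell → Cell
      welldef  : ∀ ρ j ρ' j' → SameFace ρ j ρ' j' → ∀ a τ → τ ∈δ ρ , j → Ω ρ j a τ ≡ Ω ρ' j' a τ
      closed   : ∀ ρ j a τ → τ ∈δ ρ , j → Ω ρ j a τ ∈δ ρ , j
      hom-id   : ∀ ρ j a τ → toℕ a ≡ 0 → τ ∈δ ρ , j → Ω ρ j a τ ≡ τ
      hom      : ∀ ρ j a b τ → τ ∈δ ρ , j → Ω ρ j (a ⊕ b) τ ≡ Ω ρ j a (Ω ρ j b τ)
      trans    : ∀ ρ j τ τ' → τ ∈δ ρ , j → τ' ∈δ ρ , j → ∃[ a ] Ω ρ j a τ ≡ τ'

  -- Words in G_{d,k}: the list [(j_m , l_m) , … , (j_1 , l_1)] is α_{j_m}^{l_m} ⋯ α_{j_1}^{l_1}.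
  Word : Set
  Word = List (Fin (suc d) × Fin k)

  data Reduced : Word → Set where
    []  : Reduced []
    [_] : ∀ {j l} → toℕ l ≢ 0 → Reduced ((j , l) ∷ [])
    cons : ∀ {j l j' l' w} → toℕ l ≢ 0 → j ≢ j' → Reduced ((j' , l') ∷ w) →
           Reduced ((j , l) ∷ (j' , l') ∷ w)

  -- the slot of τ whose vertex has color i (so the opposite face has colors [[d]] ∖ {i})
  slotOf : Coloring → Cell → Fin (suc d) → Slot
  slotOf Γ τ i = fromMaybe i (find (Coloring.Γ Γ ∘ vert τ) i)

  gen : Coloring → KOrdering → Fin (suc d) → Fin k → Cell → Cell
  gen Γ Ω i l τ = KOrdering.Ω Ω τ (slotOf Γ τ i) l τ

  act : Coloring → KOrdering → Word → Cell → Cell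
  act Γ Ω [] τ = τ
  act Γ Ω ((i , l) ∷ w) τ = gen Γ Ω i l (act Γ Ω w τ)

  Adjacent : Cell → Cell → Set
  Adjacent τ τ' = τ ≢ τ' × ∃[ j ] ∃[ j' ] SameFace τ j τ' j'

  data Walk : Cell → Cell → ℕ → Set where
    here : ∀ {τ} → Walk τ τ 0
    step : ∀ {τ τ' τ'' n} → Adjacent τ τ' → Walk τ' τ'' n → Walk τ τ'' (suc n)

  Dist : Cell → Cell → ℕ → Set
  Dist τ τ' m = Walk τ τ' m × (∀ n → n < m → ¬ Walk τ τ' n)

-- The d-cells form a rooted tree (each cell is a child of the cell it was attached to), and
-- the distance from a cell to 𝒯 is its depth. Along a reduced word every letter α_i^l (l ≠ 0)
-- crosses the face of the current cell opposite its vertex of color i; that face is free,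
-- since the only non-free face of a child is the one opposite its newest vertex, whose color
-- is that of the previous letter. Around a free face Ω acts simply transitively on the k cells
-- containing it, so the letter moves to a new child. Hence a reduced word of length m ends at
-- depth m and distinct reduced words end at distinct cells, while every cell is reached along
-- its path from 𝒯. Freeness at any cell τ = u.𝒯 is reduced to freeness at 𝒯 with van der
-- Waerden's normal form: w.τ = w'.τ forces wu and w'u to have equal normal forms, and w is the
-- normal form of (wu)u⁻¹.

module Submission where

open import Defs
open import Data.Nat using (ℕ; zero; suc; _+_; _∸_; _%_; _≤_; z≤n; s≤s)
import Data.Nat as ℕ
open import Data.Nat.Properties using (module ≤-Reasoning; ≤-refl; ≤-trans; ≤-antisym; m≤n⇒m≤1+n; n≤1+n; 1+n≰n; <⇒≤; <⇒≱; ≮⇒≥; +-comm; +-assoc; +-identityʳ; m∸n+n≡m)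
open import Data.Nat.DivMod using (m%n<n; %-distribˡ-+; m%n%n≡m%n; m<n⇒m%n≡m; n%n≡0)
open import Data.Fin using (Fin; zero; suc; toℕ; fromℕ<; punchOut; _≟_)
open import Data.Fin.Properties using (any?; punchOut-injective; injective⇒≤; toℕ-fromℕ<; toℕ-injective; toℕ<n)
open import Data.Maybe using (just)
import Data.Maybe as Maybe
open import Data.List using ([]; _∷_; length; _++_)
open import Data.Product using (_×_; _,_; ∃; ∃-syntax; proj₁; proj₂; uncurry′)
open import Data.Unit using (⊤; tt)
open import Function using (_∘_)
open import Function.Definitions using (Injective)
open import Relation.Nullary using (¬_; yes; no; contradiction)
open import Relation.Binary.PropositionalEquality using (_≡_; _≢_; refl; sym; trans; cong; subst; module ≡-Reasoning)

-- A missed value y would make f ∘ punchOut y an injection Fin (suc m) → Fin m.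
Fin-injective⇒surjective : ∀ {m} {f : Fin m → Fin m} → Injective _≡_ _≡_ f → ∀ y → ∃ λ x → f x ≡ y
Fin-injective⇒surjective {suc m} {f} f-inj y with any? (λ x → f x ≟ y)
... | yes hit = hit
... | no miss = contradiction (injective⇒≤ punched-inj) 1+n≰n
  where
  punched : Fin (suc m) → Fin m
  punched x = punchOut {i = y} (λ e → miss (x , sym e))
  punched-inj : Injective _≡_ _≡_ punched
  punched-inj {a} {b} e = f-inj (punchOut-injective (λ e → miss (a , sym e)) (λ e → miss (b , sym e)) e)

find-complete : ∀ {n m} (f : Fin n → Fin m) {i} j → f j ≡ i → ∃ λ t → find f i ≡ just t × f t ≡ i
find-complete {suc n} f {i} j fj≡i with f zero ≟ i
... | yes f0≡i = zero , refl , f0≡i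
find-complete {suc n} f zero    fj≡i | no f0≢i = contradiction fj≡i f0≢i
find-complete {suc n} f (suc j) fj≡i | no _ with find-complete (f ∘ suc) j fj≡i
... | t , found , ft≡i = suc t , cong (Maybe.map suc) found , ft≡i

module _ {n : ℕ} where

  private
    k : ℕ
    k = suc n

  toℕ-⊕ : ∀ (a b : Fin k) → toℕ (a ⊕ b) ≡ (toℕ a + toℕ b) % k
  toℕ-⊕ a b = toℕ-fromℕ< _

  private
    %-absorbʳ : ∀ x y → (x + y % k) % k ≡ (x + y) % k
    %-absorbʳ x y = begin
      (x + y % k) % k         ≡⟨ %-distribˡ-+ x (y % k) k ⟩
      (x % k + y % k % k) % k ≡⟨ cong (λ z → (x % k + z) % k) (m%n%n≡m%n y k) ⟩
      (x % k + y % k) % k     ≡⟨ %-distribˡ-+ x y k ⟨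
      (x + y) % k             ∎
      where open ≡-Reasoning

    %-absorbˡ : ∀ x y → (x % k + y) % k ≡ (x + y) % k
    %-absorbˡ x y = begin
      (x % k + y) % k ≡⟨ cong (_% k) (+-comm (x % k) y) ⟩
      (y + x % k) % k ≡⟨ %-absorbʳ y x ⟩
      (y + x) % k     ≡⟨ cong (_% k) (+-comm y x) ⟩
      (x + y) % k     ∎
      where open ≡-Reasoning

  ⊕-comm : ∀ (a b : Fin k) → a ⊕ b ≡ b ⊕ a
  ⊕-comm a b = toℕ-injective (begin
    toℕ (a ⊕ b)           ≡⟨ toℕ-⊕ a b ⟩
    (toℕ a + toℕ b) % k   ≡⟨ cong (_% k) (+-comm (toℕ a) (toℕ b)) ⟩
    (toℕ b + toℕ a) % k   ≡⟨ toℕ-⊕ b a ⟨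
    toℕ (b ⊕ a)           ∎)
    where open ≡-Reasoning

  ⊕-assoc : ∀ (a b c : Fin k) → a ⊕ (b ⊕ c) ≡ (a ⊕ b) ⊕ c
  ⊕-assoc a b c = toℕ-injective (begin
    toℕ (a ⊕ (b ⊕ c))                 ≡⟨ toℕ-⊕ a (b ⊕ c) ⟩
    (toℕ a + toℕ (b ⊕ c)) % k         ≡⟨ cong (λ z → (toℕ a + z) % k) (toℕ-⊕ b c) ⟩
    (toℕ a + (toℕ b + toℕ c) % k) % k ≡⟨ %-absorbʳ (toℕ a) _ ⟩
    (toℕ a + (toℕ b + toℕ c)) % k     ≡⟨ cong (_% k) (+-assoc (toℕ a) _ _) ⟨
    (toℕ a + toℕ b + toℕ c) % k       ≡⟨ %-absorbˡ (toℕ a + toℕ b) _ ⟨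
    ((toℕ a + toℕ b) % k + toℕ c) % k ≡⟨ cong (λ z → (z + toℕ c) % k) (toℕ-⊕ a b) ⟨
    (toℕ (a ⊕ b) + toℕ c) % k         ≡⟨ toℕ-⊕ (a ⊕ b) c ⟨
    toℕ ((a ⊕ b) ⊕ c)                 ∎)
    where open ≡-Reasoning

  ⊕-identityʳ : ∀ (a b : Fin k) → toℕ b ≡ 0 → a ⊕ b ≡ a
  ⊕-identityʳ a b b≡0 = toℕ-injective (begin
    toℕ (a ⊕ b)         ≡⟨ toℕ-⊕ a b ⟩
    (toℕ a + toℕ b) % k ≡⟨ cong (λ z → (toℕ a + z) % k) b≡0 ⟩
    (toℕ a + 0) % k     ≡⟨ cong (_% k) (+-identityʳ (toℕ a)) ⟩
    toℕ a % k           ≡⟨ m<n⇒m%n≡m (toℕ<n a) ⟩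
    toℕ a               ∎)
    where open ≡-Reasoning

  ⊕-identityˡ : ∀ (a b : Fin k) → toℕ a ≡ 0 → a ⊕ b ≡ b
  ⊕-identityˡ a b a≡0 = trans (⊕-comm a b) (⊕-identityʳ b a a≡0)

  infix 30 ⊖_
  ⊖_ : Fin k → Fin k
  ⊖ a = fromℕ< (m%n<n (k ∸ toℕ a) k)

  ⊕-inverseˡ : ∀ (a : Fin k) → toℕ (⊖ a ⊕ a) ≡ 0
  ⊕-inverseˡ a = begin
    toℕ (⊖ a ⊕ a)                ≡⟨ toℕ-⊕ (⊖ a) a ⟩
    (toℕ (⊖ a) + toℕ a) % k      ≡⟨ cong (λ z → (z + toℕ a) % k) (toℕ-fromℕ< (m%n<n (k ∸ toℕ a) k)) ⟩
    ((k ∸ toℕ a) % k + toℕ a) % k ≡⟨ %-absorbˡ (k ∸ toℕ a) (toℕ a) ⟩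
    (k ∸ toℕ a + toℕ a) % k      ≡⟨ cong (_% k) (m∸n+n≡m (<⇒≤ (toℕ<n a))) ⟩
    k % k                        ≡⟨ n%n≡0 k ⟩
    0                            ∎
    where open ≡-Reasoning

  ⊕-inverseʳ : ∀ (a : Fin k) → toℕ (a ⊕ ⊖ a) ≡ 0
  ⊕-inverseʳ a = trans (cong toℕ (⊕-comm a (⊖ a))) (⊕-inverseˡ a)

module Geometry (d k : ℕ) where

  open Complex d k

  depth : Cell → ℕ
  depth root = 0
  depth (child τ _ _ _) = suc (depth τ)

  infix 4 _≽_
  data _≽_ : Cell → Cell → Set where
    ≽-refl  : ∀ {X} → X ≽ X
    ≽-child : ∀ {X Z j h c} → X ≽ Z → child X j h c ≽ Z

  ≽-depth : ∀ {X Z} → X ≽ Z → depth Z ≤ depth X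
  ≽-depth ≽-refl = ≤-refl
  ≽-depth (≽-child X≽Z) = m≤n⇒m≤1+n (≽-depth X≽Z)

  ≽-root : ∀ X → X ≽ root
  ≽-root root = ≽-refl
  ≽-root (child X _ _ _) = ≽-child (≽-root X)

  ≽-antisym : ∀ {X Z} → X ≽ Z → Z ≽ X → X ≡ Z
  ≽-antisym ≽-refl _ = refl
  ≽-antisym (≽-child X≽Z) Z≽X = contradiction (≤-trans (s≤s (≽-depth X≽Z)) (≽-depth Z≽X)) 1+n≰n

  parent⋡child : ∀ {τ j h c} → ¬ (τ ≽ child τ j h c)
  parent⋡child τ≽child = 1+n≰n (≽-depth τ≽child)

  child≢parent : ∀ {τ j h c} → τ ≢ child τ j h c
  child≢parent {τ} e = parent⋡child (subst (τ ≽_) e ≽-refl)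

  child-injective : ∀ {τ j h c τ' j' h' c'} → child τ j h c ≡ child τ' j' h' c' → τ ≡ τ' × j ≡ j'
  child-injective refl = refl , refl

  child-index-injective : ∀ {τ j h c c'} → child τ j h c ≡ child τ j h c' → c ≡ c'
  child-index-injective refl = refl

  vert-child-≡ : ∀ τ j h c → vert (child τ j h c) j ≡ new τ j h c
  vert-child-≡ τ j h c with j ≟ j
  ... | yes _ = refl
  ... | no j≢j = contradiction refl j≢j

  vert-child-≢ : ∀ τ j h c {i} → i ≢ j → vert (child τ j h c) i ≡ vert τ i
  vert-child-≢ τ j h c {i} i≢j with i ≟ j
  ... | yes i≡j = contradiction i≡j i≢j
  ... | no _ = refl

  new-vertex⇒≽ : ∀ X {i τ j h c} → vert X i ≡ new τ j h c → X ≽ child τ j h c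
  new-vertex⇒≽ (child X j' h' c') {i} e with i ≟ j'
  new-vertex⇒≽ (child X j' h' c') refl | yes _ = ≽-refl
  ... | no _ = ≽-child (new-vertex⇒≽ X e)

  vert-injective : ∀ τ → Injective _≡_ _≡_ (vert τ)
  vert-injective root refl = refl
  vert-injective (child τ j h c) {i} {i'} e with i ≟ j | i' ≟ j
  ... | yes i≡j | yes i'≡j = trans i≡j (sym i'≡j)
  ... | yes _   | no _     = contradiction (new-vertex⇒≽ τ (sym e)) parent⋡child
  ... | no _    | yes _    = contradiction (new-vertex⇒≽ τ e) parent⋡child
  ... | no _    | no _     = vert-injective τ e

  ≢⇒free-child : ∀ {τ j h c j'} → j' ≢ j → Free (child τ j h c) j'
  ≢⇒free-child {j = j} {j' = j'} j'≢j with j' ≟ j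
  ... | yes j'≡j = j'≢j j'≡j
  ... | no _ = tt

  free-child⇒≢ : ∀ {τ j h c j'} → Free (child τ j h c) j' → j' ≢ j
  free-child⇒≢ {j = j} {j' = j'} free j'≡j with j' ≟ j
  ... | yes _ = free
  ... | no j'≢j = j'≢j j'≡j

  SameFace-refl : ∀ τ {j} → SameFace τ j τ j
  SameFace-refl _ v = (λ x → x) , (λ x → x)

  SameFace-sym : ∀ τ τ' {j j'} → SameFace τ j τ' j' → SameFace τ' j' τ j
  SameFace-sym _ _ s v = proj₂ (s v) , proj₁ (s v)

  SameFace-trans : ∀ τ τ' τ'' {j j' j''} → SameFace τ j τ' j' → SameFace τ' j' τ'' j'' → SameFace τ j τ'' j''
  SameFace-trans _ _ _ s t v = proj₁ (t v) ∘ proj₁ (s v) , proj₂ (s v) ∘ proj₂ (t v)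

  child-sameFace : ∀ τ j h c → SameFace (child τ j h c) j τ j
  child-sameFace τ j h c v =
      (λ { (i , i≢j , e) → i , i≢j , trans (sym (vert-child-≢ τ j h c i≢j)) e })
    , (λ { (i , i≢j , e) → i , i≢j , trans (vert-child-≢ τ j h c i≢j) e })

  sameFace⇒≡ : ∀ τ {j j'} → SameFace τ j τ j' → j ≡ j'
  sameFace⇒≡ τ {j} {j'} s with j ≟ j'
  ... | yes j≡j' = j≡j'
  ... | no j≢j' with proj₂ (s (vert τ j)) (j , j≢j' , refl)
  ... | i , i≢j , e = contradiction (vert-injective τ e) i≢j

  -- A free face of a child contains its new vertex, which only descendants of that child have.
  free-sameFace⇒≽ : ∀ τ τ' {j j'} → Free τ j → SameFace τ j τ' j' → τ' ≽ τ
  free-sameFace⇒≽ root τ' _ _ = ≽-root τ'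
  free-sameFace⇒≽ (child τ j₀ h c) τ' free s
    with proj₁ (s (new τ j₀ h c)) (j₀ , (λ e → free-child⇒≢ {τ} {j₀} {h} {c} free (sym e)) , vert-child-≡ τ j₀ h c)
  ... | _ , _ , e = new-vertex⇒≽ _ e

  free-sameFace-unique : ∀ τ τ' {j j'} → Free τ j → Free τ' j' → SameFace τ j τ' j' →
                         (τ , j) ≡ (τ' , j')
  free-sameFace-unique τ τ' free free' s
    with ≽-antisym (free-sameFace⇒≽ τ' τ free' (SameFace-sym τ τ' s)) (free-sameFace⇒≽ τ τ' free s)
  ... | refl = cong (τ ,_) (sameFace⇒≡ τ s)

  -- The cell and slot at which the face was free when it was created.
  freeRep : Cell → Slot → Cell × Slot
  freeRep root j = root , j
  freeRep (child τ j₀ h c) j with j ≟ j₀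
  ... | yes _ = τ , j
  ... | no _ = child τ j₀ h c , j

  freeRep-free : ∀ τ j → uncurry′ Free (freeRep τ j)
  freeRep-free root j = tt
  freeRep-free (child τ j₀ h c) j with j ≟ j₀
  ... | yes refl = h
  ... | no j≢j₀ = ≢⇒free-child {τ} {j₀} {h} {c} j≢j₀

  freeRep-sameFace : ∀ τ j → uncurry′ (SameFace τ j) (freeRep τ j)
  freeRep-sameFace root j = SameFace-refl root
  freeRep-sameFace (child τ j₀ h c) j with j ≟ j₀
  ... | yes refl = child-sameFace τ j h c
  ... | no _ = SameFace-refl _

  sameFace⇒freeRep≡ : ∀ τ τ' {j j'} → SameFace τ j τ' j' → freeRep τ j ≡ freeRep τ' j'
  sameFace⇒freeRep≡ τ τ' {j} {j'} s =
    free-sameFace-unique ρ ρ' (freeRep-free τ j) (freeRep-free τ' j')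
      (SameFace-trans ρ τ ρ' (SameFace-sym τ ρ (freeRep-sameFace τ j))
        (SameFace-trans τ τ' ρ' s (freeRep-sameFace τ' j')))
    where
    ρ = proj₁ (freeRep τ j)
    ρ' = proj₁ (freeRep τ' j')

  depth-freeRep-≤ : ∀ τ j → depth (proj₁ (freeRep τ j)) ≤ depth τ
  depth-freeRep-≤ root j = z≤n
  depth-freeRep-≤ (child τ j₀ h c) j with j ≟ j₀
  ... | yes _ = n≤1+n _
  ... | no _ = ≤-refl

  depth-≤-freeRep : ∀ τ j → depth τ ≤ suc (depth (proj₁ (freeRep τ j)))
  depth-≤-freeRep root j = z≤n
  depth-≤-freeRep (child τ j₀ h c) j with j ≟ j₀
  ... | yes _ = ≤-refl
  ... | no _ = n≤1+n _

  adjacent-depth : ∀ {τ τ'} → Adjacent τ τ' → depth τ ≤ suc (depth τ')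
  adjacent-depth {τ} {τ'} (_ , j , j' , s) = begin
    depth τ                               ≤⟨ depth-≤-freeRep τ j ⟩
    suc (depth (proj₁ (freeRep τ j)))   ≡⟨ cong (suc ∘ depth ∘ proj₁) (sameFace⇒freeRep≡ τ τ' s) ⟩
    suc (depth (proj₁ (freeRep τ' j'))) ≤⟨ s≤s (depth-freeRep-≤ τ' j') ⟩
    suc (depth τ')                        ∎
    where open ≤-Reasoning

  walk-depth : ∀ {τ m} → Walk τ root m → depth τ ≤ m
  walk-depth here = z≤n
  walk-depth (step adj walk) = ≤-trans (adjacent-depth adj) (s≤s (walk-depth walk))

  walk-to-root : ∀ τ → Walk τ root (depth τ)
  walk-to-root root = here
  walk-to-root (child τ j h c) =
    step ((λ e → child≢parent (sym e)) , j , j , child-sameFace τ j h c) (walk-to-root τ)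

  Dist-root⇔depth : ∀ τ m → (depth τ ≡ m → Dist τ root m) × (Dist τ root m → depth τ ≡ m)
  Dist-root⇔depth τ m =
      (λ { refl → walk-to-root τ , λ n n<depth walk → <⇒≱ n<depth (walk-depth walk) })
    , (λ { (walk , shortest) → ≤-antisym (walk-depth walk)
             (≮⇒≥ λ depth<m → shortest (depth τ) depth<m (walk-to-root τ)) })

module Colored (d k : ℕ) (Γc : Complex.Coloring d k) where

  open Complex d k
  open Geometry d k
  open Coloring Γc

  colors-surjective : ∀ τ c → ∃ λ s → Γ (vert τ s) ≡ c
  colors-surjective τ = Fin-injective⇒surjective (λ e → inj τ _ _ e)

  slotOf-color : ∀ τ c → Γ (vert τ (slotOf Γc τ c)) ≡ c
  slotOf-color τ c with colors-surjective τ c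
  ... | s , e with find-complete (Γ ∘ vert τ) s e
  ... | t , found , t-color rewrite found = t-color

  slotOf-unique : ∀ τ {c s} → Γ (vert τ s) ≡ c → slotOf Γc τ c ≡ s
  slotOf-unique τ e = inj τ _ _ (trans (slotOf-color τ _) (sym e))

  slotOf-injective : ∀ τ {c c'} → slotOf Γc τ c ≡ slotOf Γc τ c' → c ≡ c'
  slotOf-injective τ {c} {c'} e =
    trans (sym (slotOf-color τ c)) (trans (cong (Γ ∘ vert τ) e) (slotOf-color τ c'))

  -- If the colors differed, the color of ρ's opposite vertex would sit on τ's face, hence on ρ's.
  sameFace-color : ∀ τ ρ {i j} → SameFace τ i ρ j → Γ (vert τ i) ≡ Γ (vert ρ j)
  sameFace-color τ ρ {i} {j} s with Γ (vert τ i) ≟ Γ (vert ρ j)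
  ... | yes same = same
  ... | no differ with colors-surjective τ (Γ (vert ρ j))
  ... | t , t-color with proj₁ (s (vert τ t)) (t , (λ { refl → differ t-color }) , refl)
  ... | t' , t'≢j , e = contradiction (inj ρ t' j (trans (cong Γ e) t-color)) t'≢j

  child-color : ∀ τ j h c → Γ (vert (child τ j h c) j) ≡ Γ (vert τ j)
  child-color τ j h c = sameFace-color (child τ j h c) τ (child-sameFace τ j h c)

  free-child-slotOf : ∀ τ j h c {i} → Γ (vert τ j) ≢ i → Free (child τ j h c) (slotOf Γc (child τ j h c) i)
  free-child-slotOf τ j h c {i} j-color≢i = ≢⇒free-child {τ} {j} {h} {c} λ e →
    j-color≢i (trans (sym (child-color τ j h c)) (subst (λ t → Γ (vert (child τ j h c) t) ≡ i) e (slotOf-color _ i)))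

module ReducedWords (d n : ℕ) where

  open Complex d (suc n)

  HeadNot : Fin (suc d) → Word → Set
  HeadNot i [] = ⊤
  HeadNot i ((j , _) ∷ _) = i ≢ j

  ∷-reduced : ∀ {i l r} → Reduced r → HeadNot i r → toℕ l ≢ 0 → Reduced ((i , l) ∷ r)
  ∷-reduced {r = []} _ _ l≢0 = [ l≢0 ]
  ∷-reduced {r = _ ∷ _} r-reduced i≢j l≢0 = cons l≢0 i≢j r-reduced

  reduced-tail : ∀ {i l r} → Reduced ((i , l) ∷ r) → Reduced r
  reduced-tail [ _ ] = []
  reduced-tail (cons _ _ r-reduced) = r-reduced

  reduced-headNot : ∀ {i l r} → Reduced ((i , l) ∷ r) → HeadNot i r
  reduced-headNot [ _ ] = tt
  reduced-headNot (cons _ i≢j _) = i≢j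

  reduced-nonzero : ∀ {i l r} → Reduced ((i , l) ∷ r) → toℕ l ≢ 0
  reduced-nonzero [ l≢0 ] = l≢0
  reduced-nonzero (cons l≢0 _ _) = l≢0

  -- α_i^m r, for r not starting with α_i
  prepend : Fin (suc d) → Fin (suc n) → Word → Word
  prepend i m r with toℕ m ℕ.≟ 0
  ... | yes _ = r
  ... | no _ = (i , m) ∷ r

  prepend-zero : ∀ i m r → toℕ m ≡ 0 → prepend i m r ≡ r
  prepend-zero i m r m≡0 with toℕ m ℕ.≟ 0
  ... | yes _ = refl
  ... | no m≢0 = contradiction m≡0 m≢0

  prepend-nonzero : ∀ i m r → toℕ m ≢ 0 → prepend i m r ≡ (i , m) ∷ r
  prepend-nonzero i m r m≢0 with toℕ m ℕ.≟ 0
  ... | yes m≡0 = contradiction m≡0 m≢0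
  ... | no _ = refl

  prepend-reduced : ∀ i m {r} → Reduced r → HeadNot i r → Reduced (prepend i m r)
  prepend-reduced i m r-reduced i∉r with toℕ m ℕ.≟ 0
  ... | yes _ = r-reduced
  ... | no m≢0 = ∷-reduced r-reduced i∉r m≢0

  -- van der Waerden's action of the letter α_i^l on reduced words
  push : Fin (suc d) × Fin (suc n) → Word → Word
  push (i , l) [] = prepend i l []
  push (i , l) ((j , l') ∷ r) with i ≟ j
  ... | yes _ = prepend i (l ⊕ l') r
  ... | no _ = prepend i l ((j , l') ∷ r)

  push-head : ∀ i a x r → push (i , a) ((i , x) ∷ r) ≡ prepend i (a ⊕ x) r
  push-head i a x r with i ≟ i
  ... | yes _ = refl
  ... | no i≢i = contradiction refl i≢i

  push-headNot : ∀ i a r → HeadNot i r → push (i , a) r ≡ prepend i a r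
  push-headNot i a [] _ = refl
  push-headNot i a ((j , _) ∷ r) i≢j with i ≟ j
  ... | yes i≡j = contradiction i≡j i≢j
  ... | no _ = refl

  push-reduced : ∀ x {r} → Reduced r → Reduced (push x r)
  push-reduced (i , l) {[]} r-reduced = prepend-reduced i l r-reduced tt
  push-reduced (i , l) {(j , l') ∷ r} r-reduced with i ≟ j
  ... | yes refl = prepend-reduced i (l ⊕ l') (reduced-tail r-reduced) (reduced-headNot r-reduced)
  ... | no i≢j = prepend-reduced i l r-reduced i≢j

  push-identity : ∀ i l {r} → Reduced r → toℕ l ≡ 0 → push (i , l) r ≡ r
  push-identity i l {[]} _ l≡0 = prepend-zero i l [] l≡0
  push-identity i l {(j , l') ∷ r} r-reduced l≡0 with i ≟ j
  ... | yes refl = trans (cong (λ m → prepend i m r) (⊕-identityˡ l l' l≡0))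
                         (prepend-nonzero i l' r (reduced-nonzero r-reduced))
  ... | no _ = prepend-zero i l _ l≡0

  push-prepend : ∀ i a x r → HeadNot i r → push (i , a) (prepend i x r) ≡ prepend i (a ⊕ x) r
  push-prepend i a x r i∉r with toℕ x ℕ.≟ 0
  ... | yes x≡0 = trans (push-headNot i a r i∉r) (cong (λ m → prepend i m r) (sym (⊕-identityʳ a x x≡0)))
  ... | no _ = push-head i a x r

  push-hom : ∀ i a b {r} → Reduced r → push (i , a) (push (i , b) r) ≡ push (i , a ⊕ b) r
  push-hom i a b {[]} _ = push-prepend i a b [] tt
  push-hom i a b {(j , l) ∷ r} r-reduced with i ≟ j
  ... | yes refl = trans (push-prepend i a (b ⊕ l) r (reduced-headNot r-reduced))
                         (cong (λ m → prepend i m r) (⊕-assoc a b l))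
  ... | no i≢j = push-prepend i a b _ i≢j

  pushAll : Word → Word → Word
  pushAll [] r = r
  pushAll (x ∷ w) r = push x (pushAll w r)

  pushAll-reduced : ∀ w {r} → Reduced r → Reduced (pushAll w r)
  pushAll-reduced [] r-reduced = r-reduced
  pushAll-reduced (x ∷ w) r-reduced = push-reduced x (pushAll-reduced w r-reduced)

  pushAll-++ : ∀ w w' r → pushAll (w ++ w') r ≡ pushAll w (pushAll w' r)
  pushAll-++ [] w' r = refl
  pushAll-++ (x ∷ w) w' r = cong (push x) (pushAll-++ w w' r)

  pushAll-[] : ∀ {w} → Reduced w → pushAll w [] ≡ w
  pushAll-[] {[]} _ = refl
  pushAll-[] {(i , l) ∷ w} w-reduced = begin
    push (i , l) (pushAll w []) ≡⟨ cong (push (i , l)) (pushAll-[] (reduced-tail w-reduced)) ⟩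
    push (i , l) w              ≡⟨ push-headNot i l w (reduced-headNot w-reduced) ⟩
    prepend i l w               ≡⟨ prepend-nonzero i l w (reduced-nonzero w-reduced) ⟩
    (i , l) ∷ w                 ∎
    where open ≡-Reasoning

  pushAll-prepend : ∀ i m w {r} → Reduced r → pushAll (prepend i m w) r ≡ push (i , m) (pushAll w r)
  pushAll-prepend i m w r-reduced with toℕ m ℕ.≟ 0
  ... | yes m≡0 = sym (push-identity i m (pushAll-reduced w r-reduced) m≡0)
  ... | no _ = refl

  pushAll-push : ∀ x w {r} → Reduced r → pushAll (push x w) r ≡ push x (pushAll w r)
  pushAll-push (i , l) [] r-reduced = pushAll-prepend i l [] r-reduced
  pushAll-push (i , l) ((j , l') ∷ w) r-reduced with i ≟ j
  ... | yes refl = trans (pushAll-prepend i (l ⊕ l') w r-reduced)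
                         (sym (push-hom i l l' (pushAll-reduced w r-reduced)))
  ... | no _ = pushAll-prepend i l _ r-reduced

  pushAll-normalise : ∀ w {r} → Reduced r → pushAll (pushAll w []) r ≡ pushAll w r
  pushAll-normalise [] _ = refl
  pushAll-normalise (x ∷ w) r-reduced =
    trans (pushAll-push x (pushAll w []) r-reduced) (cong (push x) (pushAll-normalise w r-reduced))

  inverse : Word → Word
  inverse [] = []
  inverse ((i , l) ∷ w) = inverse w ++ (i , ⊖ l) ∷ []

  pushAll-inverse : ∀ w {r} → Reduced r → pushAll w (pushAll (inverse w) r) ≡ r
  pushAll-inverse [] _ = refl
  pushAll-inverse ((i , l) ∷ w) {r} r-reduced = begin
    push (i , l) (pushAll w (pushAll (inverse w ++ (i , ⊖ l) ∷ []) r))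
      ≡⟨ cong (push (i , l) ∘ pushAll w) (pushAll-++ (inverse w) _ r) ⟩
    push (i , l) (pushAll w (pushAll (inverse w) (push (i , ⊖ l) r)))
      ≡⟨ cong (push (i , l)) (pushAll-inverse w (push-reduced _ r-reduced)) ⟩
    push (i , l) (push (i , ⊖ l) r)
      ≡⟨ push-hom i l (⊖ l) r-reduced ⟩
    push (i , l ⊕ ⊖ l) r
      ≡⟨ push-identity i _ r-reduced (⊕-inverseʳ l) ⟩
    r ∎
    where open ≡-Reasoning

  pushAll-cancelʳ : ∀ {w u} → Reduced w → Reduced u →
                    pushAll (pushAll w u) (pushAll (inverse u) []) ≡ w
  pushAll-cancelʳ {w} {u} w-reduced u-reduced = begin
    pushAll (pushAll w u) u⁻¹              ≡⟨ cong (λ v → pushAll (pushAll w v) u⁻¹) (pushAll-[] u-reduced) ⟨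
    pushAll (pushAll w (pushAll u [])) u⁻¹ ≡⟨ cong (λ v → pushAll v u⁻¹) (pushAll-++ w u []) ⟨
    pushAll (pushAll (w ++ u) []) u⁻¹      ≡⟨ pushAll-normalise (w ++ u) (pushAll-reduced (inverse u) []) ⟩
    pushAll (w ++ u) u⁻¹                   ≡⟨ pushAll-++ w u u⁻¹ ⟩
    pushAll w (pushAll u u⁻¹)              ≡⟨ cong (pushAll w) (pushAll-inverse u []) ⟩
    pushAll w []                           ≡⟨ pushAll-[] w-reduced ⟩
    w                                      ∎
    where
    open ≡-Reasoning
    u⁻¹ = pushAll (inverse u) []

module Action (d n : ℕ) (Γc : Complex.Coloring d (suc n)) (Ωk : Complex.KOrdering d (suc n)) where

  open Complex d (suc n)
  open Geometry d (suc n)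
  open Colored d (suc n) Γc
  open ReducedWords d n
  open Coloring Γc using (Γ; inj)
  open KOrdering Ωk renaming (trans to transitive)

  infixr 5 _·_
  _·_ : Word → Cell → Cell
  w · τ = act Γc Ωk w τ

  self-∈δ : ∀ τ j → τ ∈δ τ , j
  self-∈δ τ j = j , SameFace-refl τ

  -- δ(σ) for the free face σ of A opposite a, indexed by C_k
  star : ∀ A a → Free A a → Fin (suc n) → Cell
  star A a h zero = A
  star A a h (suc c) = child A a h c

  star-injective : ∀ {A a} (h : Free A a) → Injective _≡_ _≡_ (star A a h)
  star-injective h {zero}  {zero}   _ = refl
  star-injective h {zero}  {suc _}  e = contradiction e child≢parent
  star-injective h {suc _} {zero}   e = contradiction (sym e) child≢parent
  star-injective h {suc _} {suc _}  e = cong suc (child-index-injective e)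

  star-∈δ : ∀ {A a} (h : Free A a) e → star A a h e ∈δ A , a
  star-∈δ {A} h zero = self-∈δ A _
  star-∈δ {A} {a} h (suc c) = a , child-sameFace A a h c

  -- By transitivity every cell of the star is reached, so e ↦ (an exponent reaching star e)
  -- is injective, hence onto by pigeonhole: Ω acts simply transitively there.
  module _ {A a} (h : Free A a) where

    private
      reaching : ∀ e → ∃ λ b → Ω A a b A ≡ star A a h e
      reaching e = transitive A a A (star A a h e) (self-∈δ A a) (star-∈δ h e)

      reaching-injective : Injective _≡_ _≡_ (proj₁ ∘ reaching)
      reaching-injective {e} {e'} same = star-injective h
        (trans (sym (proj₂ (reaching e))) (trans (cong (λ b → Ω A a b A) same) (proj₂ (reaching e'))))

    Ω-onto-star : ∀ b → ∃ λ e → Ω A a b A ≡ star A a h e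
    Ω-onto-star b with Fin-injective⇒surjective reaching-injective b
    ... | e , refl = e , proj₂ (reaching e)

    Ω-injective : ∀ {b b'} → Ω A a b A ≡ Ω A a b' A → b ≡ b'
    Ω-injective {b} {b'} eq
      with Fin-injective⇒surjective reaching-injective b | Fin-injective⇒surjective reaching-injective b'
    ... | e , refl | e' , refl = cong (proj₁ ∘ reaching)
      (star-injective h (trans (sym (proj₂ (reaching e))) (trans eq (proj₂ (reaching e')))))

    Ω-nonzero-child : ∀ {l} → toℕ l ≢ 0 → ∃ λ c → Ω A a l A ≡ child A a h c
    Ω-nonzero-child {l} l≢0 with Ω-onto-star l
    ... | zero , stays = contradiction
      (cong toℕ (Ω-injective (trans stays (sym (hom-id A a zero A refl (self-∈δ A a)))))) l≢0
    ... | suc c , moves = c , moves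

  gen-identity : ∀ i {l} y → toℕ l ≡ 0 → gen Γc Ωk i l y ≡ y
  gen-identity i y l≡0 = hom-id y (slotOf Γc y i) _ y l≡0 (self-∈δ y _)

  gen-hom : ∀ i a b y → gen Γc Ωk i a (gen Γc Ωk i b y) ≡ gen Γc Ωk i (a ⊕ b) y
  gen-hom i a b y = via-shared-face (closed y s b y (self-∈δ y s))
    where
    s = slotOf Γc y i
    z = Ω y s b y
    via-shared-face : z ∈δ y , s → Ω z (slotOf Γc z i) a z ≡ Ω y s (a ⊕ b) y
    via-shared-face (t , z~y) = begin
      Ω z (slotOf Γc z i) a z ≡⟨ cong (λ t' → Ω z t' a z)
                                   (slotOf-unique z (trans (sameFace-color z y z~y) (slotOf-color y i))) ⟩
      Ω z t a z               ≡⟨ welldef z t y s z~y a z (self-∈δ z t) ⟩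
      Ω y s a z               ≡⟨ hom y s a b y (self-∈δ y s) ⟨
      Ω y s (a ⊕ b) y         ∎
      where open ≡-Reasoning

  gen-inverse : ∀ i l y → gen Γc Ωk i (⊖ l) (gen Γc Ωk i l y) ≡ y
  gen-inverse i l y = trans (gen-hom i (⊖ l) l y) (gen-identity i y (⊕-inverseˡ l))

  act-++ : ∀ w w' y → (w ++ w') · y ≡ w · w' · y
  act-++ [] w' y = refl
  act-++ ((i , l) ∷ w) w' y = cong (gen Γc Ωk i l) (act-++ w w' y)

  act-prepend : ∀ i m r y → prepend i m r · y ≡ gen Γc Ωk i m (r · y)
  act-prepend i m r y with toℕ m ℕ.≟ 0
  ... | yes m≡0 = sym (gen-identity i _ m≡0)
  ... | no _ = refl

  act-push : ∀ x r y → push x r · y ≡ (x ∷ r) · y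
  act-push (i , l) [] y = act-prepend i l [] y
  act-push (i , l) ((j , l') ∷ r) y with i ≟ j
  ... | yes refl = trans (act-prepend i _ r y) (sym (gen-hom i l l' _))
  ... | no _ = act-prepend i l _ y

  act-pushAll : ∀ w r y → pushAll w r · y ≡ w · r · y
  act-pushAll [] r y = refl
  act-pushAll (x@(i , l) ∷ w) r y =
    trans (act-push x (pushAll w r) y) (cong (gen Γc Ωk i l) (act-pushAll w r y))

  act-inverse : ∀ w y → inverse w · w · y ≡ y
  act-inverse [] y = refl
  act-inverse ((i , l) ∷ w) y = begin
    (inverse w ++ (i , ⊖ l) ∷ []) · ((i , l) ∷ w) · y         ≡⟨ act-++ (inverse w) _ _ ⟩
    inverse w · gen Γc Ωk i (⊖ l) (gen Γc Ωk i l (w · y)) ≡⟨ cong (inverse w ·_) (gen-inverse i l (w · y)) ⟩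
    inverse w · w · y                                     ≡⟨ act-inverse w y ⟩
    y                                                     ∎
    where open ≡-Reasoning

  reduced-free : ∀ {i l} u → Reduced ((i , l) ∷ u) → Free (u · root) (slotOf Γc (u · root) i)

  reduced-step : ∀ {i l u} (r : Reduced ((i , l) ∷ u)) →
                 ∃ λ c → ((i , l) ∷ u) · root ≡ child (u · root) (slotOf Γc (u · root) i) (reduced-free u r) c
  reduced-step {u = u} r = Ω-nonzero-child (reduced-free u r) (reduced-nonzero r)

  reduced-free [] _ = tt
  reduced-free {i} ((i₀ , l₀) ∷ u) r with reduced-step (reduced-tail r)
  ... | c , moves = subst (λ X → Free X (slotOf Γc X i)) (sym moves)
    (free-child-slotOf σ (slotOf Γc σ i₀) _ c λ e → reduced-headNot r (trans (sym e) (slotOf-color σ i₀)))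
    where σ = u · root

  depth-reduced : ∀ {u} → Reduced u → depth (u · root) ≡ length u
  depth-reduced {[]} _ = refl
  depth-reduced {_ ∷ _} r with reduced-step r
  ... | _ , moves = trans (cong depth moves) (cong suc (depth-reduced (reduced-tail r)))

  Dist-root⇔length : ∀ {w} → Reduced w → ∀ m →
                     (length w ≡ m → Dist (w · root) root m) × (Dist (w · root) root m → length w ≡ m)
  Dist-root⇔length {w} w-reduced m =
    subst (λ x → (x ≡ m → Dist (w · root) root m) × (Dist (w · root) root m → x ≡ m))
          (depth-reduced w-reduced) (Dist-root⇔depth (w · root) m)

  root≢child : ∀ {τ j h c} → root ≢ child τ j h c
  root≢child ()

  reduced-root-injective : ∀ {u u'} → Reduced u → Reduced u' → u · root ≡ u' · root → u ≡ u'
  reduced-root-injective {[]} {[]} _ _ _ = refl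
  reduced-root-injective {[]} {_ ∷ _} _ r' e with reduced-step r'
  ... | _ , moves = contradiction (trans e moves) root≢child
  reduced-root-injective {_ ∷ _} {[]} r _ e with reduced-step r
  ... | _ , moves = contradiction (trans (sym e) moves) root≢child
  reduced-root-injective {(i , l) ∷ u} {(i' , l') ∷ u'} r r' e with reduced-step r | reduced-step r'
  ... | _ , moves | _ , moves' with child-injective (trans (sym moves) (trans e moves'))
  ... | same-parent , same-slot with reduced-root-injective (reduced-tail r) (reduced-tail r') same-parent
  ... | refl with slotOf-injective (u · root) same-slot
  ... | refl = cong (λ m → (i , m) ∷ u) (Ω-injective (reduced-free u r) e)

  reachable : ∀ τ → ∃ λ u → Reduced u × u · root ≡ τ × (∀ j → Free τ j → HeadNot (Γ (vert τ j)) u)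
  reachable root = [] , [] , refl , λ _ _ → tt
  reachable (child τ j h c)
    with reachable τ | transitive τ j τ (child τ j h c) (self-∈δ τ j) (j , child-sameFace τ j h c)
  ... | u , u-reduced , refl , heads | a , moves =
      (Γ (vert τ j) , a) ∷ u , ∷-reduced u-reduced (heads j h) a≢0 , reaches , heads′
    where
    a≢0 : toℕ a ≢ 0
    a≢0 a≡0 = child≢parent (trans (sym (hom-id τ j a τ a≡0 (self-∈δ τ j))) moves)
    reaches : Ω τ (slotOf Γc τ (Γ (vert τ j))) a τ ≡ child τ j h c
    reaches = trans (cong (λ t → Ω τ t a τ) (slotOf-unique τ refl)) moves
    heads′ : ∀ j' → Free (child τ j h c) j' → Γ (vert (child τ j h c) j') ≢ Γ (vert τ j)
    heads′ j' free e = free-child⇒≢ {τ} {j} {h} {c} free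
      (inj τ j' j (trans (cong Γ (sym (vert-child-≢ τ j h c (free-child⇒≢ {τ} {j} {h} {c} free)))) e))

  transitive-action : ∀ τ τ' → ∃[ w ] (Reduced w × w · τ ≡ τ')
  transitive-action τ τ' with reachable τ | reachable τ'
  ... | u , _ , refl , _ | v , _ , refl , _ =
      pushAll v u⁻¹ , pushAll-reduced v (pushAll-reduced (inverse u) []) , (begin
      pushAll v u⁻¹ · u · root      ≡⟨ act-pushAll v u⁻¹ _ ⟩
      v · u⁻¹ · u · root            ≡⟨ cong (v ·_) (act-pushAll (inverse u) [] _) ⟩
      v · inverse u · u · root      ≡⟨ cong (v ·_) (act-inverse u root) ⟩
      v · root                      ∎)
    where
    open ≡-Reasoning
    u⁻¹ = pushAll (inverse u) []

  free-action : ∀ τ {w w'} → Reduced w → Reduced w' → w · τ ≡ w' · τ → w ≡ w'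
  free-action τ {w} {w'} w-reduced w'-reduced e with reachable τ
  ... | u , u-reduced , refl , _ = begin
      w                           ≡⟨ pushAll-cancelʳ w-reduced u-reduced ⟨
      pushAll (pushAll w u) u⁻¹   ≡⟨ cong (λ v → pushAll v u⁻¹) same-at-root ⟩
      pushAll (pushAll w' u) u⁻¹  ≡⟨ pushAll-cancelʳ w'-reduced u-reduced ⟩
      w'                          ∎
    where
    open ≡-Reasoning
    u⁻¹ = pushAll (inverse u) []
    same-at-root : pushAll w u ≡ pushAll w' u
    same-at-root = reduced-root-injective (pushAll-reduced w u-reduced) (pushAll-reduced w' u-reduced)
      (trans (act-pushAll w u root) (trans e (sym (act-pushAll w' u root))))

lemma5p8 : ∀ (d k : ℕ) → 1 ≤ d → (Γ : Complex.Coloring d k) (Ω : Complex.KOrdering d k) →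
    (∀ (w : Complex.Word d k) → Complex.Reduced d k w → ∀ (m : ℕ) →
      ((length w ≡ m → Complex.Dist d k (Complex.act d k Γ Ω w (Complex.root)) Complex.root m)
       × (Complex.Dist d k (Complex.act d k Γ Ω w Complex.root) Complex.root m → length w ≡ m)))
    × ((∀ (τ τ' : Complex.Cell d k) → ∃[ w ] (Complex.Reduced d k w × Complex.act d k Γ Ω w τ ≡ τ'))
       × (∀ (τ : Complex.Cell d k) (w w' : Complex.Word d k) → Complex.Reduced d k w → Complex.Reduced d k w' →
          Complex.act d k Γ Ω w τ ≡ Complex.act d k Γ Ω w' τ → w ≡ w'))
-- For k = 0 the exponent group Fin 0 is empty: no letters, no children.
lemma5p8 d zero _ Γ Ω =
    (λ { [] _ m → Dist-root⇔depth root m ; ((_ , ()) ∷ _) })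
  , (λ { root root → [] , [] , refl ; root (child _ _ _ ()) ; (child _ _ _ ()) _ })
  , λ { _ [] [] _ _ _ → refl ; _ ((_ , ()) ∷ _) ; _ [] ((_ , ()) ∷ _) }
  where
  open Complex d zero
  open Geometry d zero
lemma5p8 d (suc n) _ Γ Ω =
    (λ _ w-reduced m → Dist-root⇔length w-reduced m)
  , transitive-action
  , λ τ _ _ → free-action τ
  where open Action d n Γ Ω
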